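{- Let $P_8$ be the graph obtained from the complete graph $K_9$ by deleting the edges of three pairwise vertex-disjoint paths of length 2. Then $P_8$ is an $8$-pod.
   Context: A graph $H$ is immersed in a multigraph $G$ if there is an injection $\phi:V(H)\to V(G)$ and an assignment to each edge $uv\in E(H)$ of a path in $G$ between $\phi(u)$ and $\phi(v)$ with paths of distinct edges pairwise edge-disjoint. For a positive integer $d$, a $d$-pod is a simple graph in which every vertex has degree at least $d-2$ and at most $d-2$ vertices have degree exactly $d-2$, and such that, letting $A$ be its set of vertices of degree exactly $d-2$, for every maximum matching on $A$ (i.e. $\lfloor |A|/2\rfloor$ pairwise disjoint pairs of vertices of $A$), the multigraph obtained by adding one new edge joining each chosen pair (parallel edges allowed) has no immersion of $K_d$. -}

module Defs where

open import Data.Bool using (Bool; true; false; not; _∧_; _∨_)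
open import Data.Nat as ℕ using (ℕ; _∸_; _≤_; _≡ᵇ_; _<ᵇ_; _/_)
open import Data.Fin as Fin using (Fin; toℕ; _<_)
open import Data.List using (List; []; _∷_; _++_; length; lookup; filterᵇ; allFin; concatMap)
open import Data.Bool.ListAction using (any)
open import Data.List.Relation.Unary.All using (All)
open import Data.List.Relation.Unary.Unique.Propositional using (Unique)
open import Data.List.Membership.Propositional using (_∈_)
open import Data.Product using (_×_; _,_)
open import Data.Sum using (_⊎_)
open import Data.Empty using (⊥)
open import Relation.Binary.PropositionalEquality using (_≡_; _≢_; refl; cong₂)
open import Data.Bool.Properties using (∨-comm)
open import Function.Definitions using (Injective)

record SimpleGraph (n : ℕ) : Set where
  field
    adj    : Fin n → Fin n → Bool
    sym    : ∀ i j → adj i j ≡ adj j i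
    irrefl : ∀ i → adj i i ≡ false
open SimpleGraph public

deg : ∀ {n} → SimpleGraph n → Fin n → ℕ
deg {n} G v = length (filterᵇ (adj G v) (allFin n))

-- A multigraph on Fin n is a list of edges (parallel edges allowed);
-- edges are identified by their index in the list.
Multigraph : ℕ → Set
Multigraph n = List (Fin n × Fin n)

Joins : ∀ {n} → Fin n × Fin n → Fin n → Fin n → Set
Joins (a , b) u w = (a ≡ u × b ≡ w) ⊎ (a ≡ w × b ≡ u)

data Walk {n : ℕ} (E : Multigraph n) : Fin n → Fin n → Set where
  nil  : ∀ {u} → Walk E u u
  cons : ∀ {u w v} (e : Fin (length E)) → Joins (lookup E e) u w → Walk E w v → Walk E u v

edgesOf : ∀ {n} {E : Multigraph n} {u v} → Walk E u v → List (Fin (length E))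
edgesOf nil          = []
edgesOf (cons e _ p) = e ∷ edgesOf p

vertsOf : ∀ {n} {E : Multigraph n} {u v} → Walk E u v → List (Fin n)
vertsOf {u = u} nil  = u ∷ []
vertsOf {u = u} (cons e _ p) = u ∷ vertsOf p

IsPath : ∀ {n} {E : Multigraph n} {u v} → Walk E u v → Set
IsPath p = Unique (vertsOf p)

record Immersion {k n : ℕ} (H : SimpleGraph k) (E : Multigraph n) : Set where
  field
    φ          : Fin k → Fin n
    φ-inj      : Injective _≡_ _≡_ φ
    route      : (i j : Fin k) → i < j → adj H i j ≡ true → Walk E (φ i) (φ j)
    route-path : ∀ i j (p : i < j) (q : adj H i j ≡ true) → IsPath (route i j p q)
    disjoint   : ∀ i j (p : i < j) (q : adj H i j ≡ true)
                   i' j' (p' : i' < j') (q' : adj H i' j' ≡ true) →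
                   (i ≢ i' ⊎ j ≢ j') →
                   ∀ e → e ∈ edgesOf (route i j p q) → e ∈ edgesOf (route i' j' p' q') → ⊥

K : (d : ℕ) → SimpleGraph d
K d = record { adj = λ i j → not (toℕ i ≡ᵇ toℕ j)
             ; sym = λ i j → symᵇ (toℕ i) (toℕ j)
             ; irrefl = λ i → reflᵇ (toℕ i) }
  where
    symᵇ : ∀ a b → not (a ≡ᵇ b) ≡ not (b ≡ᵇ a)
    symᵇ ℕ.zero ℕ.zero = _≡_.refl
    symᵇ ℕ.zero (ℕ.suc b) = _≡_.refl
    symᵇ (ℕ.suc a) ℕ.zero = _≡_.refl
    symᵇ (ℕ.suc a) (ℕ.suc b) = symᵇ a b
    reflᵇ : ∀ a → not (a ≡ᵇ a) ≡ false
    reflᵇ ℕ.zero = _≡_.refl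
    reflᵇ (ℕ.suc a) = reflᵇ a

edgeList : ∀ {n} → SimpleGraph n → Multigraph n
edgeList {n} G =
  concatMap (λ i → concatMap (λ j → pick i j ((toℕ i <ᵇ toℕ j) ∧ adj G i j)) (allFin n)) (allFin n)
  where
    pick : Fin n → Fin n → Bool → Multigraph n
    pick i j true  = (i , j) ∷ []
    pick i j false = []

degEq : ∀ {n} → ℕ → SimpleGraph n → Fin n → Bool
degEq d G v = deg G v ≡ᵇ (d ∸ 2)

sizeA : ∀ {n} → ℕ → SimpleGraph n → ℕ
sizeA {n} d G = length (filterᵇ (degEq d G) (allFin n))

pairVerts : ∀ {n} → Multigraph n → List (Fin n)
pairVerts = concatMap (λ { (a , b) → a ∷ b ∷ [] })

IsMaxMatchingOnA : ∀ {n} → ℕ → SimpleGraph n → Multigraph n → Set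
IsMaxMatchingOnA d G M =
  All (λ { (a , b) → deg G a ≡ d ∸ 2 × deg G b ≡ d ∸ 2 }) M
  × Unique (pairVerts M)
  × length M ≡ sizeA d G / 2

IsPod : ∀ {n} → ℕ → SimpleGraph n → Set
IsPod d G =
  (∀ v → d ∸ 2 ≤ deg G v)
  × sizeA d G ≤ d ∸ 2
  × (∀ M → IsMaxMatchingOnA d G M → Immersion (K d) (edgeList G ++ M) → ⊥)

removedOneWay : ℕ → ℕ → Bool
removedOneWay a b = any (λ { (x , y) → (a ≡ᵇ x) ∧ (b ≡ᵇ y) })
  ((0 , 1) ∷ (1 , 2) ∷ (3 , 4) ∷ (4 , 5) ∷ (6 , 7) ∷ (7 , 8) ∷ [])

removedℕ : ℕ → ℕ → Bool
removedℕ a b = removedOneWay a b ∨ removedOneWay b a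

P8adj : Fin 9 → Fin 9 → Bool
P8adj i j = adj (K 9) i j ∧ not (removedℕ (toℕ i) (toℕ j))

P8 : SimpleGraph 9
P8 = record { adj = P8adj ; sym = s ; irrefl = r }
  where
    s : ∀ i j → P8adj i j ≡ P8adj j i
    s i j = cong₂ (λ x y → x ∧ not y) (sym (K 9) i j)
                  (∨-comm (removedOneWay (toℕ i) (toℕ j)) (removedOneWay (toℕ j) (toℕ i)))
    r : ∀ i → P8adj i i ≡ false
    r i rewrite irrefl (K 9) i = refl

module Submission where

-- The degree conditions are finite computations: the vertices 1, 4, 7 have
-- degree 6 = 8 - 2 and all others degree 7.  The substance is that no maximum
-- matching M on A = {1, 4, 7} (a single edge) lets K₈ immerse in P₈ + M.
-- The argument is an edge count.  P₈ + M has 30 + 1 = 31 edges, and since the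
-- vertices of A are pairwise adjacent in P₈, no edge of P₈ + M joins one of the
-- six deleted pairs.  An immersion of K₈ routes its 28 edges along pairwise
-- edge-disjoint paths, hence uses at most 31 edges in total; but a route
-- between a deleted pair needs at least 2 edges.  The 8 branch vertices miss
-- exactly one vertex o of P₈, which lies on at most two deleted pairs, so at
-- least four deleted pairs are routed and at least 28 + 4 = 32 edges are used.

open import Defs hiding (sym)
open import Data.Bool using (Bool; true; false; not; if_then_else_)
open import Data.Bool.Properties using (∨-comm)
import Data.Bool.Properties as BoolP
open import Data.Nat as ℕ using (ℕ; suc; _+_; _≤_; _≤?_; z≤n; s≤s)
import Data.Nat.Properties as ℕP
open import Data.Fin as Fin using (Fin; toℕ; _<_)
import Data.Fin.Properties as FinP
open import Data.List using (List; []; _∷_; _++_; length; lookup; concatMap; map; allFin)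
open import Data.List.Properties using (length-++; length-map; length-tabulate)
open import Data.List.Relation.Unary.All as All using (All; []; _∷_)
import Data.List.Relation.Unary.All.Properties as AllP
open import Data.List.Relation.Unary.Any using (here; there; satisfied)
open import Data.List.Relation.Unary.AllPairs as AllPairs using ([]; _∷_)
import Data.List.Relation.Unary.AllPairs.Properties as AllPairsP
open import Data.List.Relation.Unary.Unique.Propositional using (Unique)
import Data.List.Relation.Unary.Unique.Propositional.Properties as UniqueP
open import Data.List.Relation.Binary.Disjoint.Propositional using (Disjoint)
open import Data.List.Membership.Propositional using (_∈_)
open import Data.List.Membership.Propositional.Properties using (∈-lookup; ∈-map⁻; ∈-concatMap⁻)
open import Data.Product using (Σ; ∃; ∃₂; _×_; _,_; proj₁; proj₂)
open import Data.Sum using (_⊎_; inj₁; inj₂; [_,_])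
open import Data.Empty using (⊥)
open import Data.Unit using (tt)
open import Function.Definitions using (Injective)
open import Relation.Nullary using (Dec; yes; no; ¬_; contradiction)
open import Relation.Nullary.Decidable using (toWitness; dec-false; _→-dec_)
open import Relation.Binary.Definitions using (Tri; tri<; tri≈; tri>)
open import Relation.Binary.PropositionalEquality using (_≡_; _≢_; refl; sym; trans; cong; cong₂; subst; subst₂)

∑ : {A : Set} → List A → (A → ℕ) → ℕ
∑ []       g = 0
∑ (x ∷ xs) g = g x + ∑ xs g

∑-cong : {A : Set} (xs : List A) {f g : A → ℕ} → (∀ x → f x ≡ g x) → ∑ xs f ≡ ∑ xs g
∑-cong []       f≡g = refl
∑-cong (x ∷ xs) f≡g = cong₂ _+_ (f≡g x) (∑-cong xs f≡g)

∑-mono : {A : Set} (xs : List A) {f g : A → ℕ} → (∀ x → f x ≤ g x) → ∑ xs f ≤ ∑ xs g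
∑-mono []       f≤g = z≤n
∑-mono (x ∷ xs) f≤g = ℕP.+-mono-≤ (f≤g x) (∑-mono xs f≤g)

length-concatMap : {A B : Set} (f : A → List B) (xs : List A) →
                   length (concatMap f xs) ≡ ∑ xs (λ x → length (f x))
length-concatMap f []       = refl
length-concatMap f (x ∷ xs) = trans (length-++ (f x)) (cong (length (f x) +_) (length-concatMap f xs))

concatMap-unique : {A B : Set} (f : A → List B) {xs : List A} → Unique xs →
                   (∀ x → Unique (f x)) → (∀ {x y} → x ≢ y → Disjoint (f x) (f y)) →
                   Unique (concatMap f xs)
concatMap-unique f xs-unique f-unique f-disjoint =
  UniqueP.concat⁺ (AllP.map⁺ (All.tabulate λ {x} _ → f-unique x))
                  (AllPairsP.map⁺ (AllPairs.map f-disjoint xs-unique))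

lookup-injective : {A : Set} (xs : List A) → Unique xs → Injective _≡_ _≡_ (lookup xs)
lookup-injective (x ∷ xs) (x∉ ∷ u) {Fin.zero}  {Fin.zero}  eq = refl
lookup-injective (x ∷ xs) (x∉ ∷ u) {Fin.zero}  {Fin.suc j} eq = contradiction eq (All.lookup x∉ (∈-lookup j))
lookup-injective (x ∷ xs) (x∉ ∷ u) {Fin.suc i} {Fin.zero}  eq = contradiction (sym eq) (All.lookup x∉ (∈-lookup i))
lookup-injective (x ∷ xs) (x∉ ∷ u) {Fin.suc i} {Fin.suc j} eq = cong Fin.suc (lookup-injective xs u eq)

unique-length-≤ : ∀ {n} (xs : List (Fin n)) → Unique xs → length xs ≤ n
unique-length-≤ xs u = FinP.injective⇒≤ (lookup-injective xs u)

module _ {n : ℕ} {E : Multigraph n} where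

  start-visited : ∀ {u v} (p : Walk E u v) → u ∈ vertsOf p
  start-visited nil          = here refl
  start-visited (cons e _ p) = here refl

  edge-ends-visited : ∀ {u v} (p : Walk E u v) {e} → e ∈ edgesOf p →
                      ∃₂ λ a b → Joins (lookup E e) a b × a ∈ vertsOf p × b ∈ vertsOf p
  edge-ends-visited (cons e j p) (here refl) = _ , _ , j , here refl , there (start-visited p)
  edge-ends-visited (cons e j p) (there e∈) with edge-ends-visited p e∈
  ... | a , b , joins , a∈ , b∈ = a , b , joins , there a∈ , there b∈

  joins-end : ∀ (q : Fin n × Fin n) {u w a b} → Joins q u w → Joins q a b → u ≡ a ⊎ u ≡ b
  joins-end q (inj₁ (refl , refl)) (inj₁ (refl , refl)) = inj₁ refl
  joins-end q (inj₁ (refl , refl)) (inj₂ (refl , refl)) = inj₂ refl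
  joins-end q (inj₂ (refl , refl)) (inj₁ (refl , refl)) = inj₂ refl
  joins-end q (inj₂ (refl , refl)) (inj₂ (refl , refl)) = inj₁ refl

  -- A path uses each edge at most once: a repeated edge would revisit its ends.
  path-edges-unique : ∀ {u v} (p : Walk E u v) → IsPath p → Unique (edgesOf p)
  path-edges-unique nil          _            = []
  path-edges-unique (cons e j p) (u∉ ∷ p-path) =
    All.tabulate (λ x∈ e≡x → revisits (edge-ends-visited p (subst (_∈ edgesOf p) (sym e≡x) x∈)))
    ∷ path-edges-unique p p-path
    where
    revisits : (∃₂ λ a b → Joins (lookup E e) a b × a ∈ vertsOf p × b ∈ vertsOf p) → ⊥
    revisits (a , b , joins , a∈ , b∈) with joins-end (lookup E e) j joins
    ... | inj₁ refl = All.lookup u∉ a∈ refl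
    ... | inj₂ refl = All.lookup u∉ b∈ refl

  walk-nonempty : ∀ {u v} (p : Walk E u v) → u ≢ v → 1 ≤ length (edgesOf p)
  walk-nonempty nil          u≢v = contradiction refl u≢v
  walk-nonempty (cons _ _ _) u≢v = s≤s z≤n

  walk-long : ∀ {u v} (p : Walk E u v) → u ≢ v → (∀ e → ¬ Joins (lookup E e) u v) →
              2 ≤ length (edgesOf p)
  walk-long nil                   u≢v no-edge = contradiction refl u≢v
  walk-long (cons e j nil)        u≢v no-edge = contradiction j (no-edge e)
  walk-long (cons _ _ (cons _ _ _)) u≢v no-edge = s≤s (s≤s z≤n)

Hit : ∀ {k n} → (Fin k → Fin n) → Fin n → Set
Hit φ x = ∃ λ i → φ i ≡ x

hit? : ∀ {k n} (φ : Fin k → Fin n) x → Dec (Hit φ x)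
hit? φ x = FinP.any? (λ i → φ i FinP.≟ x)

module _ {k n : ℕ} {φ : Fin k → Fin n} (φ-inj : Injective _≡_ _≡_ φ) where

  -- If k < n, some vertex is missed: otherwise choosing preimages injects Fin n into Fin k.
  some-missed : k ℕ.< n → ∃ λ o → ¬ Hit φ o
  some-missed k<n with FinP.all? (hit? φ)
  ... | yes all-hit = contradiction (FinP.injective⇒≤ preimage-injective) (ℕP.<⇒≱ k<n)
    where
    preimage-injective : Injective _≡_ _≡_ (λ x → proj₁ (all-hit x))
    preimage-injective {x} {y} eq =
      trans (sym (proj₂ (all-hit x))) (trans (cong φ eq) (proj₂ (all-hit y)))
  ... | no not-all = FinP.¬∀⟶∃¬ n (Hit φ) (hit? φ) not-all

  -- If n ≤ k + 1, at most one vertex is missed: two missed vertices together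
  -- with the image would give k + 2 distinct elements of Fin n.
  missed-unique : n ≤ suc k → ∀ {o x} → ¬ Hit φ o → x ≢ o → Hit φ x
  missed-unique n≤1+k {o} {x} o-missed x≢o with hit? φ x
  ... | yes x-hit    = x-hit
  ... | no  x-missed = contradiction (ℕP.≤-trans too-many n≤1+k) ℕP.1+n≰n
    where
    outside : ∀ {z} → ¬ Hit φ z → All (z ≢_) (map φ (allFin k))
    outside z-missed = All.tabulate λ y∈ z≡y →
      let (i , _ , y≡φi) = ∈-map⁻ φ y∈ in z-missed (i , sym (trans z≡y y≡φi))
    distinct : Unique (x ∷ o ∷ map φ (allFin k))
    distinct = (x≢o ∷ outside x-missed) ∷ outside o-missed
             ∷ UniqueP.map⁺ φ-inj (UniqueP.allFin⁺ k)
    too-many : suc (suc k) ≤ n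
    too-many = subst (_≤ n) (cong (λ m → suc (suc m)) image-size) (unique-length-≤ _ distinct)
      where
      image-size : length (map φ (allFin k)) ≡ k
      image-size = trans (length-map φ (allFin k)) (length-tabulate (λ i → i))

K-adj : ∀ {k} {i j : Fin k} → i < j → adj (K k) i j ≡ true
K-adj {i = i} {j} i<j = cong not (dec-false (toℕ i ℕ.≟ toℕ j) (ℕP.<⇒≢ i<j))

sorted-joins : ∀ {n} (q : Fin n × Fin n) {x y x' y'} → x < y → x' < y' →
               Joins q x y → Joins q x' y' → x ≡ x' × y ≡ y'
sorted-joins q x<y x'<y' (inj₁ (refl , refl)) (inj₁ (refl , refl)) = refl , refl
sorted-joins q x<y x'<y' (inj₁ (refl , refl)) (inj₂ (refl , refl)) = contradiction x<y (FinP.<-asym x'<y')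
sorted-joins q x<y x'<y' (inj₂ (refl , refl)) (inj₁ (refl , refl)) = contradiction x<y (FinP.<-asym x'<y')
sorted-joins q x<y x'<y' (inj₂ (refl , refl)) (inj₂ (refl , refl)) = refl , refl

-- For an immersion of K_k in E, link x y lists the edges of the route between
-- the branch vertices x < y (empty if x, y are not both branch vertices).
-- Distinct pairs get disjoint links, so all links together use at most |E| edges.
module Links {k n : ℕ} {E : Multigraph n} (I : Immersion (K k) E) where
  open Immersion I

  Edge : Set
  Edge = Fin (length E)

  routeEdges : (i j : Fin k) → Tri (i < j) (i ≡ j) (j < i) → List Edge
  routeEdges i j (tri< i<j _ _) = edgesOf (route i j i<j (K-adj i<j))
  routeEdges i j (tri≈ _ _ _)   = []
  routeEdges i j (tri> _ _ j<i) = edgesOf (route j i j<i (K-adj j<i))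

  linkFor : ∀ x y → Dec (x < y) → Dec (Hit φ x) → Dec (Hit φ y) → List Edge
  linkFor x y (yes _) (yes (i , _)) (yes (j , _)) = routeEdges i j (FinP.<-cmp i j)
  linkFor x y _       _             _             = []

  link : Fin n → Fin n → List Edge
  link x y = linkFor x y (x FinP.<? y) (hit? φ x) (hit? φ y)

  record OnLink (x y : Fin n) (e : Edge) : Set where
    field
      x<y      : x < y
      i j      : Fin k
      i<j      : i < j
      ends     : Joins (φ i , φ j) x y
      on-route : e ∈ edgesOf (route i j i<j (K-adj i<j))

  on-link : ∀ {x y e} → e ∈ link x y → OnLink x y e
  on-link {x} {y} {e} = go (x FinP.<? y) (hit? φ x) (hit? φ y)
    where
    go : ∀ x<y? x? y? → e ∈ linkFor x y x<y? x? y? → OnLink x y e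
    go (yes x<y) (yes (i , refl)) (yes (j , refl)) e∈ with FinP.<-cmp i j
    ... | tri< i<j _ _ = record { x<y = x<y ; i<j = i<j ; ends = inj₁ (refl , refl) ; on-route = e∈ }
    ... | tri> _ _ j<i = record { x<y = x<y ; i<j = j<i ; ends = inj₂ (refl , refl) ; on-route = e∈ }

  link-unique : ∀ x y → Unique (link x y)
  link-unique x y = go (x FinP.<? y) (hit? φ x) (hit? φ y)
    where
    routeEdges-unique : ∀ i j c → Unique (routeEdges i j c)
    routeEdges-unique i j (tri< i<j _ _) = path-edges-unique _ (route-path i j i<j (K-adj i<j))
    routeEdges-unique i j (tri≈ _ _ _)   = []
    routeEdges-unique i j (tri> _ _ j<i) = path-edges-unique _ (route-path j i j<i (K-adj j<i))
    go : ∀ x<y? x? y? → Unique (linkFor x y x<y? x? y?)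
    go (yes _) (yes (i , _)) (yes (j , _)) = routeEdges-unique i j (FinP.<-cmp i j)
    go (yes _) (yes _)       (no _)        = []
    go (yes _) (no _)        _             = []
    go (no _)  _             _             = []

  -- Links of distinct pairs lie on routes of distinct edges of K_k.
  link-disjoint : ∀ {x y x' y'} → x ≢ x' ⊎ y ≢ y' → Disjoint (link x y) (link x' y')
  link-disjoint {x} {y} {x'} {y'} pair≢ (e∈ , e∈') = separate (on-link e∈) (on-link e∈')
    where
    separate : ∀ {e} → OnLink x y e → OnLink x' y' e → ⊥
    separate l l' with OnLink.i l FinP.≟ OnLink.i l' | OnLink.j l FinP.≟ OnLink.j l'
    ... | yes refl | yes refl with sorted-joins _ (OnLink.x<y l) (OnLink.x<y l') (OnLink.ends l) (OnLink.ends l')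
    ...   | refl , refl = [ (λ ne → ne refl) , (λ ne → ne refl) ] pair≢
    separate l l' | no i≢i' | _ =
      disjoint _ _ (OnLink.i<j l) _ _ _ (OnLink.i<j l') _ (inj₁ i≢i') _ (OnLink.on-route l) (OnLink.on-route l')
    separate l l' | yes _ | no j≢j' =
      disjoint _ _ (OnLink.i<j l) _ _ _ (OnLink.i<j l') _ (inj₂ j≢j') _ (OnLink.on-route l) (OnLink.on-route l')

  link-walk : ∀ {x y} → x < y → Hit φ x → Hit φ y →
              (Σ (Walk E x y) λ p → edgesOf p ≡ link x y) ⊎ (Σ (Walk E y x) λ p → edgesOf p ≡ link x y)
  link-walk {x} {y} x<y x-hit y-hit = go (x FinP.<? y) (hit? φ x) (hit? φ y)
    where
    go : ∀ x<y? x? y? → (Σ (Walk E x y) λ p → edgesOf p ≡ linkFor x y x<y? x? y?)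
                        ⊎ (Σ (Walk E y x) λ p → edgesOf p ≡ linkFor x y x<y? x? y?)
    go (yes _) (yes (i , refl)) (yes (j , refl)) with FinP.<-cmp i j
    ... | tri< i<j _ _ = inj₁ (route i j i<j (K-adj i<j) , refl)
    ... | tri≈ _ i≡j _ = contradiction (cong φ i≡j) (FinP.<⇒≢ x<y)
    ... | tri> _ _ j<i = inj₂ (route j i j<i (K-adj j<i) , refl)
    go (yes _)    (yes _)      (no y-missed) = contradiction y-hit y-missed
    go (yes _)    (no x-missed) _            = contradiction x-hit x-missed
    go (no x≮y)   _             _            = contradiction x<y x≮y

  link-total : ∑ (allFin n) (λ x → ∑ (allFin n) λ y → length (link x y)) ≤ length E
  link-total = subst (_≤ length E) total-length (unique-length-≤ all-links all-links-unique)
    where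
    row : Fin n → List Edge
    row x = concatMap (link x) (allFin n)
    all-links : List Edge
    all-links = concatMap row (allFin n)
    rows-disjoint : ∀ {x x'} → x ≢ x' → Disjoint (row x) (row x')
    rows-disjoint {x} {x'} x≢x' (e∈ , e∈')
      with satisfied (∈-concatMap⁻ (link x) {allFin n} e∈) | satisfied (∈-concatMap⁻ (link x') {allFin n} e∈')
    ... | y , e∈xy | y' , e∈x'y' = link-disjoint {x} {y} {x'} {y'} (inj₁ x≢x') (e∈xy , e∈x'y')
    all-links-unique : Unique all-links
    all-links-unique =
      concatMap-unique row (UniqueP.allFin⁺ n)
        (λ x → concatMap-unique (link x) (UniqueP.allFin⁺ n) (link-unique x) (λ y≢y' → link-disjoint (inj₂ y≢y')))
        rows-disjoint
    total-length : length all-links ≡ ∑ (allFin n) (λ x → ∑ (allFin n) λ y → length (link x y))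
    total-length = trans (length-concatMap row (allFin n)) (∑-cong (allFin n) (λ x → length-concatMap (link x) (allFin n)))

Deleted : Fin 9 → Fin 9 → Bool
Deleted x y = removedℕ (toℕ x) (toℕ y)

Deleted-sym : ∀ x y → Deleted x y ≡ Deleted y x
Deleted-sym x y = ∨-comm (removedOneWay (toℕ x) (toℕ y)) (removedOneWay (toℕ y) (toℕ x))

Kept : Fin 9 × Fin 9 → Set
Kept (a , b) = Deleted a b ≡ false

-- Finite checks: every vertex has degree ≥ 6, only 1, 4, 7 have degree 6
-- (so |A| = 3), the 30 edges of P₈ are kept, and the vertices of degree 6 are
-- pairwise not deleted, so matching edges are kept as well.
minimum-degree : ∀ v → 6 ≤ deg P8 v
minimum-degree = toWitness {a? = FinP.all? λ v → 6 ≤? deg P8 v} tt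

few-low-degree : sizeA 8 P8 ≤ 6
few-low-degree = toWitness {a? = sizeA 8 P8 ≤? 6} tt

P8-edges-kept : All Kept (edgeList P8)
P8-edges-kept = toWitness {a? = All.all? (λ { (a , b) → Deleted a b BoolP.≟ false }) (edgeList P8)} tt

low-degree-pairs-kept : ∀ a b → deg P8 a ≡ 6 → deg P8 b ≡ 6 → Deleted a b ≡ false
low-degree-pairs-kept = toWitness {a? = FinP.all? λ a → FinP.all? λ b →
  (deg P8 a ℕ.≟ 6) →-dec ((deg P8 b ℕ.≟ 6) →-dec (Deleted a b BoolP.≟ false))} tt

kept-joins : {E : Multigraph 9} → All Kept E → ∀ e {u v} → Joins (lookup E e) u v → Deleted u v ≡ false
kept-joins E-kept e (inj₁ (refl , refl)) = All.lookup E-kept (∈-lookup e)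
kept-joins E-kept e {u} {v} (inj₂ (refl , refl)) = trans (Deleted-sym u v) (All.lookup E-kept (∈-lookup e))

-- the least number of edges of a walk joining two distinct vertices
weight : Fin 9 → Fin 9 → ℕ
weight x y = if Deleted x y then 2 else 1

weight-sym : ∀ x y → weight x y ≡ weight y x
weight-sym x y = cong (λ b → if b then 2 else 1) (Deleted-sym x y)

walk-weight : {E : Multigraph 9} → All Kept E → ∀ {u v} (p : Walk E u v) → u ≢ v →
              weight u v ≤ length (edgesOf p)
walk-weight E-kept {u} {v} p u≢v with Deleted u v in deleted
... | false = walk-nonempty p u≢v
... | true  = walk-long p u≢v λ e joins → contradiction (trans (sym deleted) (kept-joins E-kept e joins)) λ ()

link-weight : ∀ {k} {E : Multigraph 9} (I : Immersion (K k) E) → All Kept E →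
              let open Immersion I; open Links I in
              ∀ {x y} → x < y → Hit φ x → Hit φ y → weight x y ≤ length (link x y)
link-weight I E-kept {x} {y} x<y x-hit y-hit with Links.link-walk I x<y x-hit y-hit
... | inj₁ (p , edges≡) = subst (weight x y ≤_) (cong length edges≡) (walk-weight E-kept p (FinP.<⇒≢ x<y))
... | inj₂ (p , edges≡) = subst₂ _≤_ (weight-sym y x) (cong length edges≡)
                            (walk-weight E-kept p (λ y≡x → FinP.<⇒≢ x<y (sym y≡x)))

-- The total weight of the pairs x < y avoiding o is at least 28 + 4 = 32:
-- removing o destroys at most two of the six deleted pairs.
pair-weight : Fin 9 → Fin 9 → Fin 9 → ℕ
pair-weight o x y with x FinP.<? y | x FinP.≟ o | y FinP.≟ o
... | yes _ | no _ | no _ = weight x y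
... | _     | _    | _    = 0

pair-weight-≤ : ∀ o x y {ℓ} → (x < y → x ≢ o → y ≢ o → weight x y ≤ ℓ) → pair-weight o x y ≤ ℓ
pair-weight-≤ o x y bound with x FinP.<? y | x FinP.≟ o | y FinP.≟ o
... | yes x<y | no x≢o | no y≢o = bound x<y x≢o y≢o
... | yes _   | no _   | yes _  = z≤n
... | yes _   | yes _  | _      = z≤n
... | no _    | _      | _      = z≤n

avoiding-weight : Fin 9 → ℕ
avoiding-weight o = ∑ (allFin 9) λ x → ∑ (allFin 9) λ y → pair-weight o x y

avoiding-weight-≥ : ∀ o → 32 ≤ avoiding-weight o
avoiding-weight-≥ = toWitness {a? = FinP.all? λ o → 32 ≤? avoiding-weight o} tt

no-K8-immersion : ∀ M → IsMaxMatchingOnA 8 P8 M → ¬ Immersion (K 8) (edgeList P8 ++ M)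
no-K8-immersion M (M-on-A , _ , M-size) I
  with o , o-missed ← some-missed (Immersion.φ-inj I) (s≤s ℕP.≤-refl) =
  ℕP.1+n≰n (begin
    32                                                          ≤⟨ avoiding-weight-≥ o ⟩
    avoiding-weight o                                           ≤⟨ ∑-mono (allFin 9) (λ x → ∑-mono (allFin 9) (routed x)) ⟩
    ∑ (allFin 9) (λ x → ∑ (allFin 9) λ y → length (link x y))   ≤⟨ link-total ⟩
    length E                                                    ≡⟨ E-size ⟩
    31                                                          ∎)
  where
  open Immersion I
  open Links I
  open ℕP.≤-Reasoning
  E : Multigraph 9
  E = edgeList P8 ++ M
  E-size : length E ≡ 31
  E-size = trans (length-++ (edgeList P8) {M}) (cong (30 +_) M-size)
  E-kept : All Kept E
  E-kept = AllP.++⁺ P8-edges-kept (All.map (λ { {a , b} (a-deg , b-deg) → low-degree-pairs-kept a b a-deg b-deg }) M-on-A)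
  routed : ∀ x y → pair-weight o x y ≤ length (link x y)
  routed x y = pair-weight-≤ o x y λ x<y x≢o y≢o →
    link-weight I E-kept x<y (missed-unique φ-inj ℕP.≤-refl o-missed x≢o) (missed-unique φ-inj ℕP.≤-refl o-missed y≢o)

lemma4p5 : IsPod 8 P8
lemma4p5 = minimum-degree , few-low-degree , no-K8-immersion
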